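{- The number $8542$ is not representable.
   Context: A positive integer $m$ is called representable if there exists a finite set $X$ of distinct positive integers such that $\sum_{x\in X} \frac{1}{x} = 1$ and $\sum_{x\in X} x^2 = m$. -}

module Defs where

open import Data.Nat using (ℕ; zero; suc; _*_; _<_)
open import Data.Integer using (+_)
open import Data.Rational using (ℚ; _/_; 0ℚ; 1ℚ) renaming (_+_ to _+ℚ_)
open import Data.List using (List; []; _∷_; map)
open import Data.Nat.ListAction using (sum)
open import Data.List.Relation.Unary.All using (All)
open import Data.List.Relation.Unary.Unique.Propositional using (Unique)
open import Data.Product using (Σ; _×_)
open import Relation.Binary.PropositionalEquality using (_≡_)

-- reciprocal 1/x as a rational; the value at 0 is irrelevant (elements are required positive)
recip : ℕ → ℚ
recip zero    = 0ℚ
recip (suc k) = (+ 1) / suc k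

recipSum : List ℕ → ℚ
recipSum []       = 0ℚ
recipSum (x ∷ xs) = recip x +ℚ recipSum xs

sqSum : List ℕ → ℕ
sqSum xs = sum (map (λ x → x * x) xs)

-- A finite set X of distinct positive integers is represented by a duplicate-free list.
Representable : ℕ → Set
Representable m =
  Σ (List ℕ) λ X → Unique X × All (0 <_) X × recipSum X ≡ 1ℚ × sqSum X ≡ m

-- Every element x of such a set X satisfies x² ≤ 8542, so X ⊆ {1, …, 92}. With L = lcm(1, …, 92)
-- and w(x) = L / x, the condition ∑ 1/x = 1 becomes the integer equation ∑ w(x) = L, so X is a
-- subset of {1, …, 92} with (∑ x², ∑ w(x)) = (8542, L). An exhaustive search over all subsets
-- rules this out: candidates are added one at a time, and a partial sum (s, r) is kept only if
-- the remaining candidates can still complete it, i.e. if their squares and weights leave room to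
-- reach 8542 and L, and if L − r is divisible by the gcd of their weights. Taking the candidates
-- in order of decreasing largest prime factor makes the divisibility test prune early, and no
-- partial sum survives.
module Submission where

open import Defs
open import Relation.Nullary using (¬_)

open import Data.Integer as ℤ using (+_)
import Data.Integer.Properties as ℤ
open import Data.List using (List; []; _∷_; map; foldr; filter; _++_; applyUpTo)
open import Data.List.Membership.Propositional using (_∈_)
open import Data.List.Membership.Propositional.Properties
  using (∈-++⁺ˡ; ∈-++⁺ʳ; ∈-map⁺; ∈-filter⁺; ∈-filter⁻; ∈-applyUpTo⁺)
open import Data.List.Membership.Propositional.Properties.WithK using (unique∧set⇒bag)
open import Data.List.Relation.Binary.BagAndSetEquality using (∼bag⇒↭)
open import Data.List.Relation.Binary.Permutation.Propositional using (_↭_)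
import Data.List.Relation.Binary.Permutation.Propositional.Properties as ↭
open import Data.List.Relation.Binary.Sublist.Propositional using (_⊆_; []; _∷_; _∷ʳ_)
import Data.List.Relation.Binary.Sublist.Propositional.Properties as ⊆
open import Data.List.Relation.Unary.All as All using (All; []; _∷_; all?)
open import Data.List.Relation.Unary.Any using (here; there)
open import Data.List.Relation.Unary.Unique.Propositional using (Unique)
open import Data.List.Relation.Unary.Unique.Propositional.Properties as Unique using ()
open import Data.Nat as ℕ using (ℕ; zero; suc; _+_; _*_; _∸_; _≤_; _<_; _/_; z≤n; NonZero)
open import Data.List.Relation.Unary.Unique.DecPropositional ℕ._≟_ using (unique?)
open import Data.List.Membership.DecPropositional ℕ._≟_ using (_∈?_)
open import Data.Nat.Divisibility using (_∣_; _∣?_; _∣0; ∣-trans; ∣m∣n⇒∣m+n)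
open import Data.Nat.GCD using (gcd; gcd[m,n]∣m; gcd[m,n]∣n)
open import Data.Nat.ListAction using (sum)
open import Data.Nat.ListAction.Properties using (sum-↭)
open import Data.Nat.Properties
open import Data.Nat.Tactic.RingSolver using (solve-∀)
open import Data.Product using (_×_; _,_; proj₂)
open import Data.Rational using (1ℚ; toℚᵘ) renaming (_+_ to _+ℚ_)
open import Data.Rational.Properties using (toℚᵘ-homo-+; toℚᵘ-fromℚᵘ; toℚᵘ-cong)
open import Data.Rational.Unnormalised using (_≃_; *≡*) renaming (_/_ to _/ᵘ_; _+_ to _+ᵘ_)
import Data.Rational.Unnormalised.Properties as ℚᵘ
open import Function.Bundles using (mk⇔)
open import Relation.Binary.Definitions using (DecidableEquality)
open import Relation.Binary.PropositionalEquality
open import Relation.Nullary using (contradiction; yes; no)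
open import Relation.Nullary.Decidable using (_×-dec_; from-yes)
open import Relation.Unary using (Decidable)

module _ {A : Set} (_≟_ : DecidableEquality A) where

  open import Data.List.Membership.DecPropositional _≟_ using () renaming (_∈?_ to _∈ᴬ?_)

  filter-∈-↭ : ∀ {xs ys : List A} → Unique xs → Unique ys → All (_∈ ys) xs →
               filter (_∈ᴬ? xs) ys ↭ xs
  filter-∈-↭ {xs} {ys} xs! ys! xs⊆ys =
    ∼bag⇒↭ (unique∧set⇒bag (Unique.filter⁺ (_∈ᴬ? xs) ys!) xs!
      (mk⇔ (λ v∈ → proj₂ (∈-filter⁻ (_∈ᴬ? xs) {xs = ys} v∈))
           (λ v∈xs → ∈-filter⁺ (_∈ᴬ? xs) (All.lookup xs⊆ys v∈xs) v∈xs)))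

sum-mono-⊆ : ∀ {xs ys} → xs ⊆ ys → sum xs ≤ sum ys
sum-mono-⊆ []        = z≤n
sum-mono-⊆ (y ∷ʳ p)  = ≤-trans (sum-mono-⊆ p) (m≤n+m _ y)
sum-mono-⊆ (refl ∷ p) = +-monoʳ-≤ _ (sum-mono-⊆ p)

∣-sum : ∀ {d xs} → All (d ∣_) xs → d ∣ sum xs
∣-sum []       = _ ∣0
∣-sum (p ∷ ps) = ∣m∣n⇒∣m+n p (∣-sum ps)

foldr-gcd-∣ : ∀ xs → All (foldr gcd 0 xs ∣_) xs
foldr-gcd-∣ []       = []
foldr-gcd-∣ (x ∷ xs) =
  gcd[m,n]∣m x _ ∷ All.map (∣-trans (gcd[m,n]∣n x _)) (foldr-gcd-∣ xs)

∈⇒≤sum-map : ∀ (f : ℕ → ℕ) {x xs} → x ∈ xs → f x ≤ sum (map f xs)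
∈⇒≤sum-map f (here refl) = m≤m+n _ _
∈⇒≤sum-map f (there p)   = ≤-trans (∈⇒≤sum-map f p) (m≤n+m _ _)

*-self-<⇒< : ∀ {m n} → m * m < n * n → m < n
*-self-<⇒< {m} {n} m²<n² with m <? n
... | yes m<n = m<n
... | no  m≮n = contradiction m²<n² (≤⇒≯ (*-mono-≤ n≤m n≤m))
  where n≤m = ≮⇒≥ m≮n

+/ᵘ-≃⁺ : ∀ a b c d .{{_ : NonZero b}} .{{_ : NonZero d}} →
         a * d ≡ c * b → + a /ᵘ b ≃ + c /ᵘ d
+/ᵘ-≃⁺ a (suc b) c (suc d) eq = *≡* (begin
  + a ℤ.* + suc d   ≡⟨ ℤ.pos-* a (suc d) ⟨
  + (a * suc d)     ≡⟨ cong +_ eq ⟩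
  + (c * suc b)     ≡⟨ ℤ.pos-* c (suc b) ⟩
  + c ℤ.* + suc b   ∎)
  where open ≡-Reasoning

+/ᵘ-≃⁻ : ∀ a b c d .{{_ : NonZero b}} .{{_ : NonZero d}} →
         + a /ᵘ b ≃ + c /ᵘ d → a * d ≡ c * b
+/ᵘ-≃⁻ a (suc b) c (suc d) (*≡* eq) =
  ℤ.+-injective (trans (ℤ.pos-* a (suc d)) (trans eq (sym (ℤ.pos-* c (suc b)))))

+/ᵘ-+ : ∀ a b c d .{{_ : NonZero b}} .{{_ : NonZero d}} →
        (+ a /ᵘ b) +ᵘ (+ c /ᵘ d) ≃ (+ (a * d + c * b) /ᵘ (b * d)) {{m*n≢0 b d}}
+/ᵘ-+ a (suc b) c (suc d) = ℚᵘ.≃-reflexive (ℚᵘ./-cong numerator refl)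
  where
  numerator : + a ℤ.* + suc d ℤ.+ + c ℤ.* + suc b ≡ + (a * suc d + c * suc b)
  numerator = trans (cong₂ ℤ._+_ (sym (ℤ.pos-* a (suc d))) (sym (ℤ.pos-* c (suc b))))
                    (sym (ℤ.pos-+ (a * suc d) (c * suc b)))

unit-fraction-+ : ∀ x w W L .{{_ : NonZero x}} .{{_ : NonZero L}} → x * w ≡ L →
                  (+ 1 /ᵘ x) +ᵘ (+ W /ᵘ L) ≃ + (w + W) /ᵘ L
unit-fraction-+ x w W L xw≡L = ℚᵘ.≃-trans (+/ᵘ-+ 1 x W L)
  (+/ᵘ-≃⁺ (1 * L + W * x) (x * L) (w + W) L {{m*n≢0 x L}}
    (subst (λ L → (1 * L + W * x) * L ≡ (w + W) * (x * L)) xw≡L (identity x w W)))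
  where
  identity : ∀ x w W → (1 * (x * w) + W * x) * (x * w) ≡ (w + W) * (x * (x * w))
  identity = solve-∀

toℚᵘ-recipSum : ∀ (w : ℕ → ℕ) L .{{_ : NonZero L}} X → All (λ x → x * w x ≡ L) X →
                toℚᵘ (recipSum X) ≃ + sum (map w X) /ᵘ L
toℚᵘ-recipSum w L []           []           = +/ᵘ-≃⁺ 0 1 0 L refl
toℚᵘ-recipSum w L (zero ∷ X)   (0≡L ∷ _)    = contradiction (sym 0≡L) (ℕ.≢-nonZero⁻¹ L)
toℚᵘ-recipSum w L (suc k ∷ X) (x*w≡L ∷ hX) = begin
  toℚᵘ (recip (suc k) +ℚ recipSum X)              ≈⟨ toℚᵘ-homo-+ (recip (suc k)) (recipSum X) ⟩
  toℚᵘ (recip (suc k)) +ᵘ toℚᵘ (recipSum X)       ≈⟨ ℚᵘ.+-cong (toℚᵘ-fromℚᵘ (+ 1 /ᵘ suc k))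
                                                                 (toℚᵘ-recipSum w L X hX) ⟩
  (+ 1 /ᵘ suc k) +ᵘ (+ sum (map w X) /ᵘ L)        ≈⟨ unit-fraction-+ (suc k) (w (suc k)) _ L x*w≡L ⟩
  + (w (suc k) + sum (map w X)) /ᵘ L              ∎
  where open ℚᵘ.≃-Reasoning

recipSum≡1⇒sum≡ : ∀ (w : ℕ → ℕ) L .{{_ : NonZero L}} X → All (λ x → x * w x ≡ L) X →
                   recipSum X ≡ 1ℚ → sum (map w X) ≡ L
recipSum≡1⇒sum≡ w L X hX recip≡1 = begin
  sum (map w X)       ≡⟨ *-identityʳ _ ⟨
  sum (map w X) * 1   ≡⟨ +/ᵘ-≃⁻ 1 1 (sum (map w X)) L 1≃W/L ⟨
  1 * L               ≡⟨ *-identityˡ L ⟩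
  L                   ∎
  where
  open ≡-Reasoning
  1≃W/L : toℚᵘ 1ℚ ≃ + sum (map w X) /ᵘ L
  1≃W/L = ℚᵘ.≃-trans (toℚᵘ-cong (sym recip≡1)) (toℚᵘ-recipSum w L X hX)

module Search (w : ℕ → ℕ) (t ℓ : ℕ) where

  weightSum : List ℕ → ℕ
  weightSum xs = sum (map w xs)

  commonDivisor : List ℕ → ℕ
  commonDivisor xs = foldr gcd 0 (map w xs)

  State : Set
  State = ℕ × ℕ

  extend : ℕ → State → State
  extend x (s , r) = s + x * x , r + w x

  Feasible : ℕ → ℕ → ℕ → State → Set
  Feasible a b d (s , r) = (s ≤ t × t ≤ s + a) × (r ≤ ℓ × ℓ ≤ r + b) × d ∣ ℓ ∸ r

  feasible? : ∀ a b d → Decidable (Feasible a b d)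
  feasible? a b d (s , r) =
    ((s ≤? t) ×-dec (t ≤? s + a)) ×-dec ((r ≤? ℓ) ×-dec (ℓ ≤? r + b)) ×-dec (d ∣? ℓ ∸ r)

  Completable : List ℕ → State → Set
  Completable ys = Feasible (sqSum ys) (weightSum ys) (commonDivisor ys)

  -- Kept η-reduced so that the three bounds are evaluated once per step, not once per state.
  completable? : ∀ ys → Decidable (Completable ys)
  completable? ys = feasible? (sqSum ys) (weightSum ys) (commonDivisor ys)

  survivors : List ℕ → List State → List State
  survivors []       S = S
  survivors (x ∷ ys) S = survivors ys (filter (completable? ys) (S ++ map (extend x) S))

  feasible : ∀ {a b d s r A B} → A ≤ a → B ≤ b → d ∣ B → s + A ≡ t → r + B ≡ ℓ →
             Feasible a b d (s , r)
  feasible {s = s} {r} {A} {B} A≤a B≤b d∣B refl refl =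
    (m≤m+n s A , +-monoʳ-≤ s A≤a) , (m≤m+n r B , +-monoʳ-≤ r B≤b) ,
    subst (_ ∣_) (sym (m+n∸m≡n r B)) d∣B

  completable : ∀ {zs ys s r} → zs ⊆ ys → s + sqSum zs ≡ t → r + weightSum zs ≡ ℓ →
                Completable ys (s , r)
  completable {zs} {ys} zs⊆ys =
    feasible (sum-mono-⊆ (⊆.map⁺ _ zs⊆ys)) (sum-mono-⊆ (⊆.map⁺ w zs⊆ys))
             (∣-sum (⊆.All-resp-⊆ (⊆.map⁺ w zs⊆ys) (foldr-gcd-∣ (map w ys))))

  survivors-complete : ∀ {zs ys S s r} → zs ⊆ ys → (s , r) ∈ S →
                       s + sqSum zs ≡ t → r + weightSum zs ≡ ℓ → (t , ℓ) ∈ survivors ys S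
  survivors-complete {s = s} {r} [] sr∈S s≡t r≡ℓ =
    subst (_∈ _) (cong₂ _,_ (trans (sym (+-identityʳ s)) s≡t) (trans (sym (+-identityʳ r)) r≡ℓ))
          sr∈S
  survivors-complete {ys = y ∷ ys} (y ∷ʳ zs⊆ys) sr∈S s≡t r≡ℓ =
    survivors-complete zs⊆ys
      (∈-filter⁺ (completable? ys) (∈-++⁺ˡ sr∈S) (completable zs⊆ys s≡t r≡ℓ)) s≡t r≡ℓ
  survivors-complete {zs = x ∷ zs} {x ∷ ys} {S} {s} {r} (refl ∷ zs⊆ys) sr∈S s≡t r≡ℓ =
    survivors-complete zs⊆ys
      (∈-filter⁺ (completable? ys) (∈-++⁺ʳ S (∈-map⁺ (extend x) sr∈S))
        (completable zs⊆ys s′≡t r′≡ℓ)) s′≡t r′≡ℓ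
    where
    s′≡t : s + x * x + sqSum zs ≡ t
    s′≡t = trans (+-assoc s (x * x) _) s≡t
    r′≡ℓ : r + w x + weightSum zs ≡ ℓ
    r′≡ℓ = trans (+-assoc r (w x) _) r≡ℓ

L : ℕ
L = 718766754945489455304472257065075294400

weight : ℕ → ℕ
weight zero    = 0
weight (suc k) = L / suc k

candidates : List ℕ
candidates =
  89 ∷ 83 ∷ 79 ∷ 73 ∷ 71 ∷ 67 ∷ 61 ∷ 59 ∷ 53 ∷ 47 ∷ 86 ∷ 43 ∷ 82 ∷ 41 ∷ 74 ∷ 37 ∷ 62 ∷ 31 ∷
  87 ∷ 58 ∷ 29 ∷ 92 ∷ 69 ∷ 46 ∷ 23 ∷ 76 ∷ 57 ∷ 38 ∷ 19 ∷ 85 ∷ 68 ∷ 51 ∷ 34 ∷ 17 ∷ 91 ∷ 78 ∷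
  65 ∷ 52 ∷ 39 ∷ 26 ∷ 13 ∷ 88 ∷ 77 ∷ 66 ∷ 55 ∷ 44 ∷ 33 ∷ 22 ∷ 11 ∷ 84 ∷ 70 ∷ 63 ∷ 56 ∷ 49 ∷
  42 ∷ 35 ∷ 28 ∷ 21 ∷ 14 ∷ 7 ∷ 90 ∷ 80 ∷ 75 ∷ 60 ∷ 50 ∷ 45 ∷ 40 ∷ 30 ∷ 25 ∷ 20 ∷ 15 ∷ 10 ∷
  5 ∷ 81 ∷ 72 ∷ 54 ∷ 48 ∷ 36 ∷ 27 ∷ 24 ∷ 18 ∷ 12 ∷ 9 ∷ 6 ∷ 3 ∷ 64 ∷ 32 ∷ 16 ∷ 8 ∷ 4 ∷ 2 ∷ 1 ∷ []

candidates-complete : All (_∈ candidates) (applyUpTo suc 92)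
candidates-complete = from-yes (all? (_∈? candidates) (applyUpTo suc 92))

candidates-unique : Unique candidates
candidates-unique = from-yes (unique? candidates)

weight-exact : All (λ x → x * weight x ≡ L) candidates
weight-exact = from-yes (all? (λ x → x * weight x ℕ.≟ L) candidates)

open Search weight 8542 L

no-survivors : survivors candidates ((0 , 0) ∷ []) ≡ []
no-survivors = refl

∈-candidates : ∀ {x X} → 0 < x → x ∈ X → sqSum X ≡ 8542 → x ∈ candidates
∈-candidates {suc k} 0<x x∈X sq≡ =
  All.lookup candidates-complete (∈-applyUpTo⁺ suc (≤-pred x<93))
  where
  x<93 : suc k < 93
  x<93 = *-self-<⇒< (≤-<-trans (subst (_ ≤_) sq≡ (∈⇒≤sum-map (λ x → x * x) x∈X))
                               (from-yes (8542 <? 93 * 93)))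

lemma2 : ¬ Representable 8542
lemma2 (X , X-unique , X-positive , recip≡1 , sq≡) =
  contradiction (subst ((8542 , L) ∈_) no-survivors survivor) λ ()
  where
  X⊆candidates : All (_∈ candidates) X
  X⊆candidates = All.tabulate (λ x∈X → ∈-candidates (All.lookup X-positive x∈X) x∈X sq≡)

  Z↭X : filter (_∈? X) candidates ↭ X
  Z↭X = filter-∈-↭ ℕ._≟_ X-unique candidates-unique X⊆candidates

  sqZ : sqSum (filter (_∈? X) candidates) ≡ 8542
  sqZ = trans (sum-↭ (↭.map⁺ _ Z↭X)) sq≡

  weightZ : weightSum (filter (_∈? X) candidates) ≡ L
  weightZ = trans (sum-↭ (↭.map⁺ weight Z↭X))
                  (recipSum≡1⇒sum≡ weight L X
                    (All.tabulate (λ x∈X → All.lookup weight-exact (All.lookup X⊆candidates x∈X)))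
                    recip≡1)

  -- The implicit arguments are given so that unification does not evaluate the search.
  survivor : (8542 , L) ∈ survivors candidates ((0 , 0) ∷ [])
  survivor = survivors-complete {ys = candidates} {S = (0 , 0) ∷ []}
               (⊆.filter-⊆ (_∈? X) candidates) (here refl) sqZ weightZ
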